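{- Let $\ell\ge4$ be an integer. Let $a_0,a_1,\dots,a_n$ be integers such that $a_i\ge a_0=a_n$ for all $0\le i\le n$ and $|a_i-a_{i+1}|\le1$ for all $0\le i<n$. If \[n\ge\left(\ell-1+\frac{2(\ell-2)}{\ell-3}\right)(\ell-2)^{\max_{0\le i\le n}(a_i-a_0)}-\frac{2(\ell-2)}{\ell-3},\] then there exist indices $0\le i_1<i_2<\cdots<i_\ell\le n$ and an integer $w$ such that $a_{i_1}=a_{i_2}=\cdots=a_{i_\ell}=w$ and $a_i\ge w$ for all $i_1\le i\le i_\ell$. -}

module Defs where

open import Data.Nat using (ℕ; zero; suc)
import Data.Nat as ℕ
open import Data.Integer using (ℤ; +_; _⊔_)
import Data.Integer as ℤ
open import Data.Rational using (ℚ; 0ℚ; _/_)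
import Data.Rational as ℚ

maxUpTo : (ℕ → ℤ) → ℕ → ℤ
maxUpTo f zero    = f zero
maxUpTo f (suc n) = maxUpTo f n ⊔ f (suc n)

-- the rational constant 2(ℓ-2)/(ℓ-3); only meaningful for ℓ ≥ 4
-- (for ℓ = 4 + k we have ℓ - 3 = suc k and ℓ - 2 = k + 2).
frac : ℕ → ℚ
frac (suc (suc (suc (suc k)))) = (+ (2 ℕ.* (k ℕ.+ 2))) / suc k
frac _ = 0ℚ

bound : ℕ → ℕ → ℚ
bound ℓ M =
  ((+ (ℓ ℕ.∸ 1) / 1) ℚ.+ frac ℓ) ℚ.* (+ ((ℓ ℕ.∸ 2) ℕ.^ M) / 1) ℚ.- frac ℓ

{-# OPTIONS --safe #-}
module Submission where

-- With w = a 0 and h = M the sequence is an excursion of height h: it starts and ends at w, stays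
-- in [w, w + h] and moves by at most 1 per step.  Put d = ℓ - 2 and induct on h.  Cut the excursion
-- at its returns to w.  If some return comes more than threshold d (h - 1) + 1 steps after the
-- previous one, the path strictly between them is an excursion of height h - 1 at level w + 1 that
-- is long enough for the induction hypothesis.  Otherwise the first d returns arrive within
-- d (threshold d (h - 1) + 1) < n steps, and 0, these d returns and n are ℓ visits to the minimum w.
-- The recursion threshold d h = d (threshold d (h - 1) + 2), threshold d 0 = d + 1 solves exactly
-- to the paper's bound, as one checks after clearing the denominator ℓ - 3.

open import Defs
open import Data.Nat using (ℕ; zero; suc; _∸_)
import Data.Nat as ℕ
open import Data.Integer using (ℤ; +_; _-_; ∣_∣)
import Data.Integer as ℤ
open import Data.Rational using (_/_)
import Data.Rational as ℚ
open import Data.Product using (Σ; _×_)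
open import Relation.Binary.PropositionalEquality using (_≡_)

open import Data.Nat using (_+_; _*_; _^_; _≤_; _<_; z≤n; s≤s; s≤s⁻¹; NonZero; _<?_)
open import Data.Nat.Properties using (≤-refl; ≤-trans; <-trans; ≤-<-trans; <-≤-trans; <⇒≤; ≰⇒>; +-monoʳ-≤; +-monoʳ-<; +-monoˡ-≤; +-cancelˡ-≤; +-cancelˡ-<; +-identityʳ; +-suc; m≤m+n; *-monoʳ-<; *-assoc; *-identityˡ; *-identityʳ; m<1+n⇒m<n∨m≡n; m≤n⇒∃[o]m+o≡n)
import Data.Integer.Properties as ℤP
import Data.Integer.Tactic.RingSolver as ℤSolver
open import Data.Nat.Tactic.RingSolver using (solve-∀)
open import Data.Rational.Unnormalised as ℚᵘ using (ℚᵘ; mkℚᵘ; ↥_; ↧_; *≡*; *≤*)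
import Data.Rational.Unnormalised.Properties as ℚᵘP
import Data.Rational.Properties as ℚP
open import Data.Product using (∃; _,_)
open import Data.Sum using (_⊎_; inj₁; inj₂; [_,_]′)
open import Function using (id)
open import Relation.Nullary using (¬_; yes; no)
open import Relation.Unary using (Decidable)
open import Relation.Binary.PropositionalEquality using (_≢_; refl; sym; trans; cong; subst; subst₂; module ≡-Reasoning)

least : {P : ℕ → Set} → Decidable P → ∀ {n} → P n →
        ∃ λ m → m ≤ n × P m × (∀ {i} → i < m → ¬ P i)
least P? {zero} p = 0 , z≤n , p , λ ()
least {P} P? {suc n} p with P? 0
... | yes p₀ = 0 , z≤n , p₀ , λ ()
... | no ¬p₀ with least {λ i → P (suc i)} (λ i → P? (suc i)) p
...   | m , m≤n , pm , below = suc m , s≤s m≤n , pm , λ { {zero} _ → ¬p₀ ; {suc i} (s≤s i<m) → below i<m }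

increasing⇒< : {f : ℕ → ℕ} {m : ℕ} → (∀ {i} → i < m → f i < f (suc i)) →
               ∀ {i j} → i < j → j ≤ m → f i < f j
increasing⇒< inc {i} {suc j} i<1+j 1+j≤m with m<1+n⇒m<n∨m≡n i<1+j
... | inj₂ refl = inc 1+j≤m
... | inj₁ i<j  = <-trans (increasing⇒< inc i<j (<⇒≤ 1+j≤m)) (inc 1+j≤m)

m≤n∧n+o<m+p⇒o<p : ∀ {m n o p} → m ≤ n → n + o < m + p → o < p
m≤n∧n+o<m+p⇒o<p {m} {n} {o} {p} m≤n lt = +-cancelˡ-< m o p (≤-<-trans (+-monoˡ-≤ o m≤n) lt)

i-j≤k⇒i≤j+k : ∀ {i j k} → i - j ℤ.≤ k → i ℤ.≤ j ℤ.+ k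
i-j≤k⇒i≤j+k {i} {j} i-j≤k = subst (ℤ._≤ _) (j+[i-j]≡i j i) (ℤP.+-monoʳ-≤ j i-j≤k)
  where
  j+[i-j]≡i : ∀ j i → j ℤ.+ (i - j) ≡ i
  j+[i-j]≡i = ℤSolver.solve-∀

∣x-w∣≤1∧w<x⇒x≡1+w : ∀ {w x} → ∣ x - w ∣ ℕ.≤ 1 → w ℤ.< x → x ≡ ℤ.suc w
∣x-w∣≤1∧w<x⇒x≡1+w {w} {x} ∣x-w∣≤1 w<x = ℤP.≤-antisym x≤1+w (ℤP.i<j⇒suc[i]≤j w<x)
  where
  x-w≤1 : x - w ℤ.≤ + 1
  x-w≤1 = subst (ℤ._≤ + 1) (ℤP.0≤i⇒+∣i∣≡i (ℤP.i≤j⇒0≤j-i (ℤP.<⇒≤ w<x))) (ℤ.+≤+ ∣x-w∣≤1)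
  x≤1+w : x ℤ.≤ ℤ.suc w
  x≤1+w = subst (x ℤ.≤_) (ℤP.+-comm w (+ 1)) (i-j≤k⇒i≤j+k x-w≤1)

maxUpTo-upper : ∀ f n {i} → i ≤ n → f i ℤ.≤ maxUpTo f n
maxUpTo-upper f zero    z≤n = ℤP.≤-refl
maxUpTo-upper f (suc n) i≤1+n with m<1+n⇒m<n∨m≡n (s≤s i≤1+n)
... | inj₁ (s≤s i≤n) = ℤP.≤-trans (maxUpTo-upper f n i≤n) (ℤP.i≤i⊔j (maxUpTo f n) (f (suc n)))
... | inj₂ refl      = ℤP.i≤j⊔i (maxUpTo f n) (f (suc n))

record Excursion (a : ℕ → ℤ) (w : ℤ) (n h : ℕ) : Set where
  field
    start   : a 0 ≡ w
    end     : a n ≡ w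
    floor   : ∀ {i} → i ≤ n → w ℤ.≤ a i
    ceiling : ∀ {i} → i ≤ n → a i ℤ.≤ w ℤ.+ + h
    step    : ∀ {i} → i < n → ∣ a i - a (suc i) ∣ ℕ.≤ 1

-- m + 1 visits, indexed 0 … m.
record Visits (a : ℕ → ℤ) (w : ℤ) (m n : ℕ) : Set where
  field
    visit      : ℕ → ℕ
    increasing : ∀ {i} → i < m → visit i < visit (suc i)
    last≤      : visit m ≤ n
    visit≡     : ∀ {i} → i ≤ m → a (visit i) ≡ w

record Valley (m : ℕ) (a : ℕ → ℤ) (n : ℕ) : Set where
  field
    level  : ℤ
    visits : Visits a level m n
    above  : ∀ {i} → Visits.visit visits 0 ≤ i → i ≤ Visits.visit visits m → level ℤ.≤ a i

excursion-suffix : ∀ {a w q n h} → Excursion a w (q + n) h → a q ≡ w →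
                   Excursion (λ i → a (q + i)) w n h
excursion-suffix {a} {q = q} ex aq≡w = record
  { start   = trans (cong a (+-identityʳ q)) aq≡w
  ; end     = end
  ; floor   = λ i≤n → floor (+-monoʳ-≤ q i≤n)
  ; ceiling = λ i≤n → ceiling (+-monoʳ-≤ q i≤n)
  ; step    = λ {i} i<n → subst (λ j → ∣ a (q + i) - a j ∣ ℕ.≤ 1) (sym (+-suc q i)) (step (+-monoʳ-< q i<n))
  }
  where open Excursion ex

excursion-inner : ∀ {a w n h r} → Excursion a w n (suc h) →
                  2 + r ≤ n → a (2 + r) ≡ w → (∀ {i} → i ≤ r → a (suc i) ≢ w) →
                  Excursion (λ i → a (suc i)) (ℤ.suc w) r h
excursion-inner {a} {w} {n} {h} {r} ex 2+r≤n a[2+r]≡w no-return = record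
  { start   = ∣x-w∣≤1∧w<x⇒x≡1+w (subst (ℕ._≤ 1) (sym ∣a₁-w∣≡∣a₀-a₁∣) (step (≤-trans (s≤s z≤n) 2+r≤n))) (above z≤n)
  ; end     = ∣x-w∣≤1∧w<x⇒x≡1+w (subst (λ y → ∣ a (suc r) - y ∣ ℕ.≤ 1) a[2+r]≡w (step 2+r≤n)) (above ≤-refl)
  ; floor   = λ i≤r → ℤP.i<j⇒suc[i]≤j (above i≤r)
  ; ceiling = λ i≤r → subst (a _ ℤ.≤_) (w+[1+h]≡1+w+h w h) (ceiling (inside i≤r))
  ; step    = λ i<r → step (≤-trans (s≤s i<r) (<⇒≤ 2+r≤n))
  }
  where
  open Excursion ex
  inside : ∀ {i} → i ≤ r → suc i ≤ n
  inside i≤r = ≤-trans (s≤s i≤r) (<⇒≤ 2+r≤n)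
  above : ∀ {i} → i ≤ r → w ℤ.< a (suc i)
  above i≤r = ℤP.≤∧≢⇒< (floor (inside i≤r)) (λ w≡a → no-return i≤r (sym w≡a))
  w+[1+h]≡1+w+h : ∀ w h → w ℤ.+ + suc h ≡ ℤ.suc w ℤ.+ + h
  w+[1+h]≡1+w+h w h = begin
    w ℤ.+ + suc h           ≡⟨ cong (λ x → w ℤ.+ x) (ℤP.pos-+ 1 h) ⟩
    w ℤ.+ (+ 1 ℤ.+ + h)     ≡⟨ ℤP.+-assoc w (+ 1) (+ h) ⟨
    (w ℤ.+ + 1) ℤ.+ + h     ≡⟨ cong (ℤ._+ + h) (ℤP.+-comm w (+ 1)) ⟩
    ℤ.suc w ℤ.+ + h         ∎
    where open ≡-Reasoning
  ∣a₁-w∣≡∣a₀-a₁∣ : ∣ a 1 - w ∣ ≡ ∣ a 0 - a 1 ∣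
  ∣a₁-w∣≡∣a₀-a₁∣ = trans (ℤP.∣i-j∣≡∣j-i∣ (a 1) w) (cong (λ x → ∣ x - a 1 ∣) (sym start))

excursion-flat : ∀ {a w n m} → Excursion a w n 0 → m ≤ n → Visits a w m n
excursion-flat {a} {w} ex m≤n = record
  { visit      = id
  ; increasing = λ _ → ≤-refl
  ; last≤      = m≤n
  ; visit≡     = λ i≤m → ℤP.≤-antisym (subst (a _ ℤ.≤_) (ℤP.+-identityʳ w) (ceiling (≤-trans i≤m m≤n)))
                                      (floor (≤-trans i≤m m≤n))
  }
  where open Excursion ex

excursion-endpoints : ∀ {a w n h} → Excursion a w n h → 0 < n → Visits a w 1 n
excursion-endpoints {n = n} ex 0<n = record
  { visit      = endpoint
  ; increasing = λ { {zero} _ → 0<n ; {suc _} (s≤s ()) }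
  ; last≤      = ≤-refl
  ; visit≡     = λ { {zero} _ → start ; {suc zero} _ → end ; {suc (suc _)} (s≤s ()) }
  }
  where
  open Excursion ex
  endpoint : ℕ → ℕ
  endpoint zero    = 0
  endpoint (suc _) = n

excursion-valley : ∀ {a w n h m} → Excursion a w n h → Visits a w m n → Valley m a n
excursion-valley ex vs = record
  { level  = _
  ; visits = vs
  ; above  = λ _ i≤last → Excursion.floor ex (≤-trans i≤last (Visits.last≤ vs))
  }

visits-shift : ∀ {a w m p n n′} → p + n′ ≤ n → Visits (λ i → a (p + i)) w m n′ → Visits a w m n
visits-shift {p = p} p+n′≤n vs = record
  { visit      = λ i → p + visit i
  ; increasing = λ i<m → +-monoʳ-< p (increasing i<m)
  ; last≤      = ≤-trans (+-monoʳ-≤ p last≤) p+n′≤n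
  ; visit≡     = visit≡
  }
  where open Visits vs

visits-cons : ∀ {a w m q n n′} → a 0 ≡ w → 0 < q → q + n′ ≤ n →
              Visits (λ i → a (q + i)) w m n′ → Visits a w (suc m) n
visits-cons {a} {w} {m} {q} a₀≡w 0<q q+n′≤n vs = record
  { visit      = visit′
  ; increasing = increasing′
  ; last≤      = ≤-trans (+-monoʳ-≤ q last≤) q+n′≤n
  ; visit≡     = visit≡′
  }
  where
  open Visits vs
  visit′ : ℕ → ℕ
  visit′ zero    = 0
  visit′ (suc i) = q + visit i
  increasing′ : ∀ {i} → i < suc m → visit′ i < visit′ (suc i)
  increasing′ {zero}  _         = <-≤-trans 0<q (m≤m+n q (visit 0))
  increasing′ {suc i} (s≤s i<m) = +-monoʳ-< q (increasing i<m)
  visit≡′ : ∀ {i} → i ≤ suc m → a (visit′ i) ≡ w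
  visit≡′ {zero}  _         = a₀≡w
  visit≡′ {suc i} (s≤s i≤m) = visit≡ i≤m

valley-shift : ∀ {a m p n n′} → p + n′ ≤ n → Valley m (λ i → a (p + i)) n′ → Valley m a n
valley-shift {a} {m} {p} p+n′≤n v = record
  { level  = level
  ; visits = visits-shift p+n′≤n visits
  ; above  = above′
  }
  where
  open Valley v
  open Visits visits
  above′ : ∀ {i} → p + visit 0 ≤ i → i ≤ p + visit m → level ℤ.≤ a i
  above′ lo hi with m≤n⇒∃[o]m+o≡n (≤-trans (m≤m+n p (visit 0)) lo)
  ... | j , refl = above (+-cancelˡ-≤ p _ _ lo) (+-cancelˡ-≤ p _ _ hi)

threshold : ℕ → ℕ → ℕ
threshold d zero    = suc d
threshold d (suc h) = d * (2 + threshold d h)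

module _ (d : ℕ) .{{_ : NonZero d}} where

  module _ {h : ℕ} (valley-below : ∀ {a w n} → Excursion a w n h → threshold d h ≤ n → Valley (suc d) a n) where

    first-return-or-valley : ∀ {a w n} → Excursion a w n (suc h) → 0 < n →
      Valley (suc d) a n ⊎ ∃ λ q → 0 < q × q ≤ suc (threshold d h) × q ≤ n × a q ≡ w
    first-return-or-valley {a} {w} {suc n} ex _
      with least {λ i → a (suc i) ≡ w} (λ i → a (suc i) ℤ.≟ w) (Excursion.end ex)
    ... | m , m≤n , returns , before with threshold d h <? m
    ...   | no short = inj₂ (suc m , s≤s z≤n , ≰⇒> short , s≤s m≤n , returns)
    ...   | yes (s≤s T≤r) = inj₁ (valley-shift (s≤s (<⇒≤ m≤n))
              (valley-below (excursion-inner ex (s≤s m≤n) returns (λ i≤r → before (s≤s i≤r))) T≤r))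

    returns-or-valley : ∀ j {a w n} → Excursion a w n (suc h) → j * suc (threshold d h) < n →
                        Valley (suc d) a n ⊎ Visits a w (suc j) n
    returns-or-valley zero    ex 0<n = inj₂ (excursion-endpoints ex 0<n)
    returns-or-valley (suc j) ex room with first-return-or-valley ex (≤-<-trans z≤n room)
    ... | inj₁ v = inj₁ v
    ... | inj₂ (q , 0<q , q≤G , q≤n , a[q]≡w) with m≤n⇒∃[o]m+o≡n q≤n
    ...   | n′ , refl with returns-or-valley j (excursion-suffix ex a[q]≡w) (m≤n∧n+o<m+p⇒o<p q≤G room)
    ...     | inj₁ v  = inj₁ (valley-shift ≤-refl v)
    ...     | inj₂ vs = inj₂ (visits-cons (Excursion.start ex) 0<q ≤-refl vs)

  excursion-has-valley : ∀ h {a w n} → Excursion a w n h → threshold d h ≤ n → Valley (suc d) a n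
  excursion-has-valley zero    ex T≤n = excursion-valley ex (excursion-flat ex T≤n)
  excursion-has-valley (suc h) {n = n} ex T≤n =
    [ id , excursion-valley ex ]′ (returns-or-valley (excursion-has-valley h) d ex room)
    where
    room : d * suc (threshold d h) < n
    room = <-≤-trans (*-monoʳ-< d ≤-refl) T≤n

threshold-closedForm : ∀ k h →
  suc k * threshold (2 + k) h + 2 * (k + 2) ≡ (2 + k) ^ h * ((3 + k) * suc k + 2 * (k + 2))
threshold-closedForm k zero    = base k
  where
  base : ∀ k → suc k * (3 + k) + 2 * (k + 2) ≡ 1 * ((3 + k) * suc k + 2 * (k + 2))
  base = solve-∀
threshold-closedForm k (suc h) = begin
  suc k * ((2 + k) * (2 + T)) + 2 * (k + 2)  ≡⟨ unfold k T ⟩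
  (2 + k) * (suc k * T + 2 * (k + 2))        ≡⟨ cong ((2 + k) *_) (threshold-closedForm k h) ⟩
  (2 + k) * ((2 + k) ^ h * C)                 ≡⟨ *-assoc (2 + k) ((2 + k) ^ h) C ⟨
  (2 + k) ^ suc h * C                         ∎
  where
  open ≡-Reasoning
  T = threshold (2 + k) h
  C = (3 + k) * suc k + 2 * (k + 2)
  unfold : ∀ k t → suc k * ((2 + k) * (2 + t)) + 2 * (k + 2) ≡ (2 + k) * (suc k * t + 2 * (k + 2))
  unfold = solve-∀

-- The left-hand side is the numerator of boundᵘ below, exactly as ℚᵘ arithmetic computes it.
cross-multiplied : ∀ (a s c p t : ℤ) → s ℤ.* t ℤ.+ c ≡ p ℤ.* (a ℤ.* s ℤ.+ c) →
                   ((a ℤ.* s ℤ.+ c ℤ.* + 1) ℤ.* p) ℤ.* s ℤ.+ ℤ.- c ℤ.* s ≡ t ℤ.* (s ℤ.* s)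
cross-multiplied a s c p t closed = begin
  ((a ℤ.* s ℤ.+ c ℤ.* + 1) ℤ.* p) ℤ.* s ℤ.+ ℤ.- c ℤ.* s  ≡⟨ factor a s c p ⟩
  s ℤ.* (p ℤ.* (a ℤ.* s ℤ.+ c) ℤ.- c)                     ≡⟨ cong (λ x → s ℤ.* (x ℤ.- c)) closed ⟨
  s ℤ.* ((s ℤ.* t ℤ.+ c) ℤ.- c)                           ≡⟨ cancel s t c ⟩
  t ℤ.* (s ℤ.* s)                                          ∎
  where
  open ≡-Reasoning
  factor : ∀ a s c p → ((a ℤ.* s ℤ.+ c ℤ.* + 1) ℤ.* p) ℤ.* s ℤ.+ ℤ.- c ℤ.* s ≡ s ℤ.* (p ℤ.* (a ℤ.* s ℤ.+ c) ℤ.- c)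
  factor = ℤSolver.solve-∀
  cancel : ∀ s t c → s ℤ.* ((s ℤ.* t ℤ.+ c) ℤ.- c) ≡ t ℤ.* (s ℤ.* s)
  cancel = ℤSolver.solve-∀

-- For ℓ = 4 + k: s = ℓ - 3, a = ℓ - 1, c = 2 (ℓ - 2) and frac ℓ = c / s.
module _ (k h : ℕ) where
  private
    s = suc k
    a = 3 + k
    c = 2 * (k + 2)
    P = (2 + k) ^ h
    T = threshold (2 + k) h

  boundᵘ : ℚᵘ
  boundᵘ = (mkℚᵘ (+ a) 0 ℚᵘ.+ mkℚᵘ (+ c) k) ℚᵘ.* mkℚᵘ (+ P) 0 ℚᵘ.- mkℚᵘ (+ c) k

  toℚᵘ-bound : ℚ.toℚᵘ (bound (4 + k) h) ℚᵘ.≃ boundᵘ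
  toℚᵘ-bound = begin
    ℚ.toℚᵘ ((A ℚ.+ F) ℚ.* P′ ℚ.- F)
      ≈⟨ ℚP.toℚᵘ-homo-+ ((A ℚ.+ F) ℚ.* P′) (ℚ.- F) ⟩
    ℚ.toℚᵘ ((A ℚ.+ F) ℚ.* P′) ℚᵘ.+ ℚ.toℚᵘ (ℚ.- F)
      ≈⟨ ℚᵘP.+-cong (ℚP.toℚᵘ-homo-* (A ℚ.+ F) P′) (ℚP.toℚᵘ-homo‿- F) ⟩
    ℚ.toℚᵘ (A ℚ.+ F) ℚᵘ.* ℚ.toℚᵘ P′ ℚᵘ.- ℚ.toℚᵘ F
      ≈⟨ ℚᵘP.+-cong (ℚᵘP.*-cong (ℚP.toℚᵘ-homo-+ A F) ℚᵘP.≃-refl) ℚᵘP.≃-refl ⟩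
    (ℚ.toℚᵘ A ℚᵘ.+ ℚ.toℚᵘ F) ℚᵘ.* ℚ.toℚᵘ P′ ℚᵘ.- ℚ.toℚᵘ F
      ≈⟨ ℚᵘP.+-cong (ℚᵘP.*-cong (ℚᵘP.+-cong (embed (+ a) 0) (embed (+ c) k)) (embed (+ P) 0))
                    (ℚᵘP.-‿cong (embed (+ c) k)) ⟩
    boundᵘ
      ∎
    where
    open ℚᵘP.≃-Reasoning
    A = + a / 1
    F = frac (4 + k)
    P′ = + P / 1
    embed : ∀ i d → ℚ.toℚᵘ (i / suc d) ℚᵘ.≃ mkℚᵘ i d
    embed i d = ℚP.toℚᵘ-fromℚᵘ (mkℚᵘ i d)

  boundᵘ≃threshold : boundᵘ ℚᵘ.≃ mkℚᵘ (+ T) 0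
  boundᵘ≃threshold = *≡* (begin
    ↥ boundᵘ ℤ.* + 1             ≡⟨ ℤP.*-identityʳ (↥ boundᵘ) ⟩
    numerator (+ (1 * s * 1))    ≡⟨ cong (λ u → numerator (+ u)) 1*s*1≡s ⟩
    numerator (+ s)              ≡⟨ cross-multiplied (+ a) (+ s) (+ c) (+ P) (+ T) closedForm ⟩
    + T ℤ.* (+ s ℤ.* + s)        ≡⟨ cong (+ T ℤ.*_) (ℤP.pos-* s s) ⟨
    + T ℤ.* + (s * s)            ≡⟨ cong (λ u → + T ℤ.* + (u * s)) 1*s*1≡s ⟨
    + T ℤ.* ↧ boundᵘ             ∎)
    where
    open ≡-Reasoning
    numerator : ℤ → ℤ
    numerator u = ((+ a ℤ.* + s ℤ.+ + c ℤ.* + 1) ℤ.* + P) ℤ.* + s ℤ.+ ℤ.- + c ℤ.* u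
    1*s*1≡s : 1 * s * 1 ≡ s
    1*s*1≡s = trans (*-identityʳ (1 * s)) (*-identityˡ s)
    closedForm : + s ℤ.* + T ℤ.+ + c ≡ + P ℤ.* (+ a ℤ.* + s ℤ.+ + c)
    closedForm = begin
      + s ℤ.* + T ℤ.+ + c              ≡⟨ cong (ℤ._+ + c) (ℤP.pos-* s T) ⟨
      + (s * T) ℤ.+ + c                ≡⟨ ℤP.pos-+ (s * T) c ⟨
      + (s * T + c)                    ≡⟨ cong +_ (threshold-closedForm k h) ⟩
      + (P * (a * s + c))              ≡⟨ ℤP.pos-* P (a * s + c) ⟩
      + P ℤ.* + (a * s + c)            ≡⟨ cong (λ x → + P ℤ.* x) (ℤP.pos-+ (a * s) c) ⟩
      + P ℤ.* (+ (a * s) ℤ.+ + c)      ≡⟨ cong (λ x → + P ℤ.* (x ℤ.+ + c)) (ℤP.pos-* a s) ⟩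
      + P ℤ.* (+ a ℤ.* + s ℤ.+ + c)    ∎

  threshold≤ : ∀ {n} → bound (4 + k) h ℚ.≤ + n / 1 → T ≤ n
  threshold≤ {n} bound≤n with ℚᵘP.≤-respʳ-≃ (ℚP.toℚᵘ-fromℚᵘ (mkℚᵘ (+ n) 0))
                               (ℚᵘP.≤-respˡ-≃ (ℚᵘP.≃-trans toℚᵘ-bound boundᵘ≃threshold) (ℚP.toℚᵘ-mono-≤ bound≤n))
  ... | *≤* T*1≤n*1 = ℤP.drop‿+≤+ (subst₂ ℤ._≤_ (ℤP.*-identityʳ (+ T)) (ℤP.*-identityʳ (+ n)) T*1≤n*1)

lemma4p1 : (ℓ : ℕ) → 4 ℕ.≤ ℓ →
    (n : ℕ) (a : ℕ → ℤ) →
    (∀ i → i ℕ.≤ n → a 0 ℤ.≤ a i) →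
    a 0 ≡ a n →
    (∀ i → i ℕ.< n → ∣ a i - a (suc i) ∣ ℕ.≤ 1) →
    (M : ℕ) → + M ≡ maxUpTo (λ i → a i - a 0) n →
    bound ℓ M ℚ.≤ (+ n / 1) →
    Σ (ℕ → ℕ) λ idx → Σ ℤ λ w →
      ((∀ j k → j ℕ.< k → k ℕ.< ℓ → idx j ℕ.< idx k)
      × idx (ℓ ∸ 1) ℕ.≤ n
      × (∀ j → j ℕ.< ℓ → a (idx j) ≡ w)
      × (∀ i → idx 0 ℕ.≤ i → i ℕ.≤ idx (ℓ ∸ 1) → w ℤ.≤ a i))
lemma4p1 (suc (suc (suc (suc k)))) (s≤s (s≤s (s≤s (s≤s z≤n)))) n a a₀≤ a₀≡aₙ steps M M≡max bound≤n =
  visit , level , (λ _ _ j<k k<ℓ → increasing⇒< increasing j<k (s≤s⁻¹ k<ℓ)) , last≤ ,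
  (λ _ j<ℓ → visit≡ (s≤s⁻¹ j<ℓ)) , (λ _ → above)
  where
  ex : Excursion a (a 0) n M
  ex = record
    { start   = refl
    ; end     = sym a₀≡aₙ
    ; floor   = a₀≤ _
    ; ceiling = λ {i} i≤n → i-j≤k⇒i≤j+k (subst (a i - a 0 ℤ.≤_) (sym M≡max) (maxUpTo-upper (λ i → a i - a 0) n i≤n))
    ; step    = steps _
    }
  open Valley (excursion-has-valley (2 + k) M ex (threshold≤ k M bound≤n))
  open Visits visits
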